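{- Let $(Y_k)_{k\ge0}$ be a lazy simple symmetric random walk, let $\tau=\inf\{k\ge1: Y_k=0\}$ be its first return time to $0$, and $A_\tau=\sum_{i=1}^\tau Y_i$ the area of its first excursion. Define the formal power series \[ g(x,y)=\sum_{i,j>0}\mathbb{P}(A_\tau=i,\ \tau=j)\,x^iy^j. \] Then $g$ satisfies \[ g(x,y)=\frac{xy^2}{16\big(1-\frac{xy}{2}-g(x,xy)\big)}. \]
   Context: A lazy simple symmetric random walk is $Y_0=0$, $Y_k=\sum_{i=1}^k X_i$ with $X_i$ i.i.d., $\mathbb{P}(X_i=\pm1)=1/4$, $\mathbb{P}(X_i=0)=1/2$. The identity is an identity of formal power series in $x,y$ (all terms of $g$ have positive powers of $x$ and $y$). -}

module Defs where

open import Data.Nat as ℕ using (ℕ; zero; suc; _∸_; _≤ᵇ_)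
open import Data.Integer as ℤ using (ℤ; +_)
open import Data.Rational as ℚ using (ℚ; 0ℚ; 1ℚ)
open import Data.Bool using (Bool; true; false; not; _∧_; if_then_else_)
open import Data.List using (List; []; _∷_; map; concatMap; foldr)
open import Relation.Nullary using (does)

data Step : Set where
  down stay up : Step

val : Step → ℤ
val down = ℤ.-[1+ 0 ]
val stay = + 0
val up   = + 1

weight : Step → ℚ
weight down = + 1 ℚ./ 4
weight stay = + 1 ℚ./ 2
weight up   = + 1 ℚ./ 4

allSeqs : ℕ → List (List Step)
allSeqs zero    = [] ∷ []
allSeqs (suc n) = concatMap (λ s → map (s ∷_) (allSeqs n)) (down ∷ stay ∷ up ∷ [])

seqWeight : List Step → ℚ
seqWeight = foldr (λ s w → weight s ℚ.* w) 1ℚ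

positions : ℤ → List Step → List ℤ
positions y []       = []
positions y (s ∷ ss) = (y ℤ.+ val s) ∷ positions (y ℤ.+ val s) ss

isZero : ℤ → Bool
isZero y = does (y ℤ.≟ + 0)

firstReturnAtEnd : List ℤ → Bool
firstReturnAtEnd []            = false
firstReturnAtEnd (y ∷ [])      = isZero y
firstReturnAtEnd (y ∷ y' ∷ ys) = not (isZero y) ∧ firstReturnAtEnd (y' ∷ ys)

sumℤ : List ℤ → ℤ
sumℤ = foldr ℤ._+_ (+ 0)

event : ℤ → List Step → Bool
event a xs = firstReturnAtEnd (positions (+ 0) xs)
             ∧ does (sumℤ (positions (+ 0) xs) ℤ.≟ a)

-- P(A_τ = a, τ = n): the event is determined by X_1,…,X_n
prob : ℤ → ℕ → ℚ
prob a n = foldr ℚ._+_ 0ℚ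
  (map (λ xs → if event a xs then seqWeight xs else 0ℚ) (allSeqs n))

-- Formal power series in x, y over ℚ: coefficient of x^i y^j.

PS : Set
PS = ℕ → ℕ → ℚ

Σ≤ : ℕ → (ℕ → ℚ) → ℚ
Σ≤ zero    f = f 0
Σ≤ (suc n) f = Σ≤ n f ℚ.+ f (suc n)

_⊕_ : PS → PS → PS
(f ⊕ g) i j = f i j ℚ.+ g i j

_⊖_ : PS → PS → PS
(f ⊖ g) i j = f i j ℚ.- g i j

_⊛_ : PS → PS → PS
(f ⊛ g) i j = Σ≤ i (λ k → Σ≤ j (λ l → f k l ℚ.* g (i ∸ k) (j ∸ l)))

_·_ : ℚ → PS → PS
(c · f) i j = c ℚ.* f i j

mono : ℚ → ℕ → ℕ → PS
mono c m n i j = if (does (i ℕ.≟ m) ∧ does (j ℕ.≟ n)) then c else 0ℚ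

-- substitution y ↦ x y :  f(x, x y).  Coefficient of x^i y^j in
-- Σ f_{a,b} x^{a+b} y^b is f_{i-j, j} if j ≤ i, else 0.
substXY : PS → PS
substXY f i j = if (j ≤ᵇ i) then f (i ∸ j) j else 0ℚ

g : PS
g zero    _       = 0ℚ
g (suc i) zero    = 0ℚ
g (suc i) (suc j) = prob (+ suc i) (suc j)

-- A positive excursion starts with an up-step, after which the walk sits at
-- height 1.  If the next step is down, the excursion is over: x y²/16.  If it
-- is lazy, deleting it leaves an excursion with one step and one unit of area
-- less: (x y / 2) g.  If it is up, the rest splits uniquely, at the first
-- return to height 1, into a first passage 2 → 1 and a first passage 1 → 0;
-- preceded by an up-step each becomes an excursion, and the first one, lifted
-- by 1 during its m steps, gains area m, which is the substitution y ↦ x y.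
-- Hence g = x y²/16 + (x y / 2) g + g(x, y) g(x, x y), which is the identity
-- with the denominator cleared.

module Submission where

open import Defs
open import Data.Integer using (+_)
open import Data.Rational using (_/_)
open import Relation.Binary.PropositionalEquality using (_≡_)

open import Data.Bool using (Bool; true; false; _∧_; if_then_else_)
open import Data.List using (List; []; _∷_; _++_; map; foldr; length; take; drop; null)
open import Data.Nat as ℕ using (ℕ; zero; suc; pred; _∸_; _≡ᵇ_; _≤ᵇ_; _≤_; z≤n; s≤s)
open import Data.Nat.Tactic.RingSolver using (solve-∀)
open import Data.Integer as ℤ using (-[1+_])
import Data.Integer.Properties as ℤₚ
open import Data.Product using (∃-syntax; _,_)
open import Data.Bool.Properties using (∧-zeroʳ)
import Data.Nat.Properties as ℕₚ
open import Data.List.Properties using (take++drop≡id)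
open import Data.Rational using (ℚ; 0ℚ; _+_; _*_; _-_)
import Data.Rational.Properties as ℚₚ
open import Data.Rational.Solver using (module +-*-Solver)
open import Relation.Binary.PropositionalEquality
  using (refl; sym; trans; cong; cong₂; module ≡-Reasoning)

open +-*-Solver using (solve; con; _:+_; _:-_; _:*_; _:=_)
open ≡-Reasoning

infix 5 _when_

_when_ : ℚ → Bool → ℚ
x when b = if b then x else 0ℚ

0-when : ∀ b → 0ℚ when b ≡ 0ℚ
0-when true  = refl
0-when false = refl

when-∧ : ∀ x b c → x when (b ∧ c) ≡ (x when c) when b
when-∧ x true  c = refl
when-∧ x false c = refl

when-*ˡ : ∀ x y b → x * (y when b) ≡ (x * y) when b
when-*ˡ x y true  = refl
when-*ˡ x y false = ℚₚ.*-zeroʳ x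

when-*ʳ : ∀ x y b → (x when b) * y ≡ (x * y) when b
when-*ʳ x y true  = refl
when-*ʳ x y false = ℚₚ.*-zeroˡ y

when-* : ∀ x y b c → (x when b) * (y when c) ≡ (x * y) when (b ∧ c)
when-* x y true  c = when-*ˡ x y c
when-* x y false c = ℚₚ.*-zeroˡ (y when c)

sumOver : {A : Set} → List A → (A → ℚ) → ℚ
sumOver xs f = foldr _+_ 0ℚ (map f xs)

module _ {A : Set} where

  sumOver-++ : ∀ (xs ys : List A) f → sumOver (xs ++ ys) f ≡ sumOver xs f + sumOver ys f
  sumOver-++ []       ys f = sym (ℚₚ.+-identityˡ _)
  sumOver-++ (x ∷ xs) ys f =
    trans (cong (_+_ (f x)) (sumOver-++ xs ys f)) (sym (ℚₚ.+-assoc (f x) _ _))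

  sumOver-cong : ∀ (xs : List A) {f h} → (∀ x → f x ≡ h x) → sumOver xs f ≡ sumOver xs h
  sumOver-cong []       e = refl
  sumOver-cong (x ∷ xs) e = cong₂ _+_ (e x) (sumOver-cong xs e)

  sumOver-+ : ∀ (xs : List A) f h → sumOver xs (λ x → f x + h x) ≡ sumOver xs f + sumOver xs h
  sumOver-+ []       f h = refl
  sumOver-+ (x ∷ xs) f h =
    trans (cong (_+_ (f x + h x)) (sumOver-+ xs f h))
          (solve 4 (λ a b c d → (a :+ b) :+ (c :+ d) := (a :+ c) :+ (b :+ d)) refl
                 (f x) (h x) (sumOver xs f) (sumOver xs h))

  sumOver-*ˡ : ∀ (xs : List A) c f → sumOver xs (λ x → c * f x) ≡ c * sumOver xs f
  sumOver-*ˡ []       c f = sym (ℚₚ.*-zeroʳ c)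
  sumOver-*ˡ (x ∷ xs) c f =
    trans (cong (_+_ (c * f x)) (sumOver-*ˡ xs c f)) (sym (ℚₚ.*-distribˡ-+ c (f x) _))

  sumOver-*ʳ : ∀ (xs : List A) c f → sumOver xs (λ x → f x * c) ≡ sumOver xs f * c
  sumOver-*ʳ []       c f = sym (ℚₚ.*-zeroˡ c)
  sumOver-*ʳ (x ∷ xs) c f =
    trans (cong (_+_ (f x * c)) (sumOver-*ʳ xs c f)) (sym (ℚₚ.*-distribʳ-+ c (f x) _))

  sumOver-zero : ∀ (xs : List A) {f} → (∀ x → f x ≡ 0ℚ) → sumOver xs f ≡ 0ℚ
  sumOver-zero []       e = refl
  sumOver-zero (x ∷ xs) e = cong₂ _+_ (e x) (sumOver-zero xs e)

sumOver-map : ∀ {A B : Set} (h : B → A) xs f → sumOver (map h xs) f ≡ sumOver xs (λ x → f (h x))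
sumOver-map h []       f = refl
sumOver-map h (x ∷ xs) f = cong (_+_ (f (h x))) (sumOver-map h xs f)

Σ≤-cong-≤ : ∀ n {f h : ℕ → ℚ} → (∀ k → k ≤ n → f k ≡ h k) → Σ≤ n f ≡ Σ≤ n h
Σ≤-cong-≤ zero    e = e 0 z≤n
Σ≤-cong-≤ (suc n) e =
  cong₂ _+_ (Σ≤-cong-≤ n (λ k k≤n → e k (ℕₚ.m≤n⇒m≤1+n k≤n))) (e (suc n) ℕₚ.≤-refl)

Σ≤-cong : ∀ n {f h : ℕ → ℚ} → (∀ k → f k ≡ h k) → Σ≤ n f ≡ Σ≤ n h
Σ≤-cong n e = Σ≤-cong-≤ n (λ k _ → e k)

Σ≤-zero : ∀ n {f : ℕ → ℚ} → (∀ k → f k ≡ 0ℚ) → Σ≤ n f ≡ 0ℚ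
Σ≤-zero zero    e = e 0
Σ≤-zero (suc n) e = cong₂ _+_ (Σ≤-zero n e) (e (suc n))

Σ≤-+ : ∀ n (f h : ℕ → ℚ) → Σ≤ n (λ k → f k + h k) ≡ Σ≤ n f + Σ≤ n h
Σ≤-+ zero    f h = refl
Σ≤-+ (suc n) f h =
  trans (cong (_+ (f (suc n) + h (suc n))) (Σ≤-+ n f h))
        (solve 4 (λ a b c d → (a :+ b) :+ (c :+ d) := (a :+ c) :+ (b :+ d)) refl
               (Σ≤ n f) (Σ≤ n h) (f (suc n)) (h (suc n)))

Σ≤-- : ∀ n (f h : ℕ → ℚ) → Σ≤ n (λ k → f k - h k) ≡ Σ≤ n f - Σ≤ n h
Σ≤-- zero    f h = refl
Σ≤-- (suc n) f h =
  trans (cong (_+ (f (suc n) - h (suc n))) (Σ≤-- n f h))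
        (solve 4 (λ a b c d → (a :- b) :+ (c :- d) := (a :+ c) :- (b :+ d)) refl
               (Σ≤ n f) (Σ≤ n h) (f (suc n)) (h (suc n)))

Σ≤-when : ∀ n (f : ℕ → ℚ) b → Σ≤ n (λ k → f k when b) ≡ Σ≤ n f when b
Σ≤-when n f true  = refl
Σ≤-when n f false = Σ≤-zero n (λ _ → refl)

Σ≤-shift : ∀ n (f : ℕ → ℚ) → Σ≤ (suc n) f ≡ f 0 + Σ≤ n (λ k → f (suc k))
Σ≤-shift zero    f = refl
Σ≤-shift (suc n) f =
  trans (cong (_+ f (suc (suc n))) (Σ≤-shift n f)) (ℚₚ.+-assoc (f 0) _ _)

Σ≤-shift-zero : ∀ n (f : ℕ → ℚ) → f 0 ≡ 0ℚ → Σ≤ (suc n) f ≡ Σ≤ n (λ k → f (suc k))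
Σ≤-shift-zero n f f0≡0 =
  trans (Σ≤-shift n f) (trans (cong (_+ Σ≤ n (λ k → f (suc k))) f0≡0) (ℚₚ.+-identityˡ _))

Σ≤-reverse : ∀ n (f : ℕ → ℚ) → Σ≤ n f ≡ Σ≤ n (λ k → f (n ∸ k))
Σ≤-reverse zero    f = refl
Σ≤-reverse (suc n) f = begin
  Σ≤ n f + f (suc n)                      ≡⟨ cong (_+ f (suc n)) (Σ≤-reverse n f) ⟩
  Σ≤ n (λ k → f (n ∸ k)) + f (suc n)      ≡⟨ ℚₚ.+-comm _ (f (suc n)) ⟩
  f (suc n) + Σ≤ n (λ k → f (suc n ∸ suc k)) ≡⟨ Σ≤-shift n (λ k → f (suc n ∸ k)) ⟨
  Σ≤ (suc n) (λ k → f (suc n ∸ k))        ∎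

Σ≤-swap : ∀ m n (F : ℕ → ℕ → ℚ) →
  Σ≤ m (λ k → Σ≤ n (F k)) ≡ Σ≤ n (λ l → Σ≤ m (λ k → F k l))
Σ≤-swap zero    n F = refl
Σ≤-swap (suc m) n F =
  trans (cong (_+ Σ≤ n (F (suc m))) (Σ≤-swap m n F))
        (sym (Σ≤-+ n (λ l → Σ≤ m (λ k → F k l)) (F (suc m))))

suc≤ᵇsuc : ∀ m n → (suc m ≤ᵇ suc n) ≡ (m ≤ᵇ n)
suc≤ᵇsuc zero    n = refl
suc≤ᵇsuc (suc m) n = refl

≡ᵇ-comm : ∀ m n → (m ≡ᵇ n) ≡ (n ≡ᵇ m)
≡ᵇ-comm zero    zero    = refl
≡ᵇ-comm zero    (suc n) = refl
≡ᵇ-comm (suc m) zero    = refl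
≡ᵇ-comm (suc m) (suc n) = ≡ᵇ-comm m n

≤ᵇ-∧-≡ᵇ-∸ : ∀ a b c → ((a ≤ᵇ b) ∧ (c ≡ᵇ b ∸ a)) ≡ (a ℕ.+ c ≡ᵇ b)
≤ᵇ-∧-≡ᵇ-∸ zero    b       c = refl
≤ᵇ-∧-≡ᵇ-∸ (suc a) zero    c = refl
≤ᵇ-∧-≡ᵇ-∸ (suc a) (suc b) c =
  trans (cong (_∧ (c ≡ᵇ b ∸ a)) (suc≤ᵇsuc a b)) (≤ᵇ-∧-≡ᵇ-∸ a b c)

Σ≤-delta : ∀ n t (f : ℕ → ℚ) → Σ≤ n (λ k → f k when (k ≡ᵇ t)) ≡ f t when (t ≤ᵇ n)
Σ≤-delta zero    zero    f = refl
Σ≤-delta zero    (suc t) f = refl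
Σ≤-delta (suc n) zero    f = begin
  Σ≤ (suc n) (λ k → f k when (k ≡ᵇ 0))   ≡⟨ Σ≤-shift n _ ⟩
  f 0 + Σ≤ n (λ _ → 0ℚ)                  ≡⟨ cong (_+_ (f 0)) (Σ≤-zero n (λ _ → refl)) ⟩
  f 0 + 0ℚ                               ≡⟨ ℚₚ.+-identityʳ (f 0) ⟩
  f 0                                    ∎
Σ≤-delta (suc n) (suc t) f = begin
  Σ≤ (suc n) (λ k → f k when (k ≡ᵇ suc t))       ≡⟨ Σ≤-shift n _ ⟩
  0ℚ + Σ≤ n (λ k → f (suc k) when (k ≡ᵇ t))      ≡⟨ ℚₚ.+-identityˡ _ ⟩
  Σ≤ n (λ k → f (suc k) when (k ≡ᵇ t))           ≡⟨ Σ≤-delta n t (λ k → f (suc k)) ⟩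
  f (suc t) when (t ≤ᵇ n)                        ≡⟨ cong (f (suc t) when_) (suc≤ᵇsuc t n) ⟨
  f (suc t) when (suc t ≤ᵇ suc n)                ∎

Σ≤-convolution-delta : ∀ i m x y w →
  Σ≤ i (λ k → w when (((m ≤ᵇ k) ∧ (x ≡ᵇ k ∸ m)) ∧ (y ≡ᵇ i ∸ k)))
    ≡ w when (m ℕ.+ x ℕ.+ y ≡ᵇ i)
Σ≤-convolution-delta i m x y w = begin
  Σ≤ i (λ k → w when (((m ≤ᵇ k) ∧ (x ≡ᵇ k ∸ m)) ∧ (y ≡ᵇ i ∸ k)))
    ≡⟨ Σ≤-cong i (λ k → trans (cong (λ b → w when (b ∧ (y ≡ᵇ i ∸ k)))
                                    (trans (≤ᵇ-∧-≡ᵇ-∸ m k x) (≡ᵇ-comm (m ℕ.+ x) k)))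
                              (when-∧ w (k ≡ᵇ m ℕ.+ x) (y ≡ᵇ i ∸ k))) ⟩
  Σ≤ i (λ k → (w when (y ≡ᵇ i ∸ k)) when (k ≡ᵇ m ℕ.+ x))
    ≡⟨ Σ≤-delta i (m ℕ.+ x) (λ k → w when (y ≡ᵇ i ∸ k)) ⟩
  (w when (y ≡ᵇ i ∸ (m ℕ.+ x))) when (m ℕ.+ x ≤ᵇ i)
    ≡⟨ when-∧ w (m ℕ.+ x ≤ᵇ i) (y ≡ᵇ i ∸ (m ℕ.+ x)) ⟨
  w when ((m ℕ.+ x ≤ᵇ i) ∧ (y ≡ᵇ i ∸ (m ℕ.+ x)))
    ≡⟨ cong (w when_) (≤ᵇ-∧-≡ᵇ-∸ (m ℕ.+ x) i y) ⟩
  w when (m ℕ.+ x ℕ.+ y ≡ᵇ i)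
    ∎

⊛-comm : ∀ f h i j → (f ⊛ h) i j ≡ (h ⊛ f) i j
⊛-comm f h i j = begin
  Σ≤ i (λ k → Σ≤ j (λ l → f k l * h (i ∸ k) (j ∸ l)))
    ≡⟨ Σ≤-reverse i _ ⟩
  Σ≤ i (λ k → Σ≤ j (λ l → f (i ∸ k) l * h (i ∸ (i ∸ k)) (j ∸ l)))
    ≡⟨ Σ≤-cong i (λ k → Σ≤-reverse j _) ⟩
  Σ≤ i (λ k → Σ≤ j (λ l → f (i ∸ k) (j ∸ l) * h (i ∸ (i ∸ k)) (j ∸ (j ∸ l))))
    ≡⟨ Σ≤-cong-≤ i (λ k k≤i → Σ≤-cong-≤ j (λ l l≤j →
         trans (cong₂ (λ a b → f (i ∸ k) (j ∸ l) * h a b)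
                      (ℕₚ.m∸[m∸n]≡n k≤i) (ℕₚ.m∸[m∸n]≡n l≤j))
               (ℚₚ.*-comm _ (h k l)))) ⟩
  Σ≤ i (λ k → Σ≤ j (λ l → h k l * f (i ∸ k) (j ∸ l)))
    ∎

⊛-⊖ : ∀ f a b i j → (f ⊛ (a ⊖ b)) i j ≡ (f ⊛ a) i j - (f ⊛ b) i j
⊛-⊖ f a b i j =
  trans (Σ≤-cong i (λ k →
          trans (Σ≤-cong j (λ l →
                  solve 3 (λ x y z → x :* (y :- z) := x :* y :- x :* z) refl
                        (f k l) (a (i ∸ k) (j ∸ l)) (b (i ∸ k) (j ∸ l))))
                (Σ≤-- j _ _)))
        (Σ≤-- i _ _)

⊛-mono : ∀ f c m n i j →
  (f ⊛ mono c m n) i j ≡ (f (i ∸ m) (j ∸ n) * c) when ((m ≤ᵇ i) ∧ (n ≤ᵇ j))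
⊛-mono f c m n i j = begin
  (f ⊛ mono c m n) i j
    ≡⟨ ⊛-comm f (mono c m n) i j ⟩
  Σ≤ i (λ k → Σ≤ j (λ l → (c when ((k ≡ᵇ m) ∧ (l ≡ᵇ n))) * f (i ∸ k) (j ∸ l)))
    ≡⟨ Σ≤-cong i (λ k → Σ≤-cong j (λ l → term k l)) ⟩
  Σ≤ i (λ k → Σ≤ j (λ l → ((c * f (i ∸ k) (j ∸ l)) when (l ≡ᵇ n)) when (k ≡ᵇ m)))
    ≡⟨ Σ≤-cong i (λ k → Σ≤-when j _ (k ≡ᵇ m)) ⟩
  Σ≤ i (λ k → Σ≤ j (λ l → (c * f (i ∸ k) (j ∸ l)) when (l ≡ᵇ n)) when (k ≡ᵇ m))
    ≡⟨ Σ≤-cong i (λ k → cong (_when (k ≡ᵇ m)) (Σ≤-delta j n (λ l → c * f (i ∸ k) (j ∸ l)))) ⟩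
  Σ≤ i (λ k → ((c * f (i ∸ k) (j ∸ n)) when (n ≤ᵇ j)) when (k ≡ᵇ m))
    ≡⟨ Σ≤-delta i m (λ k → (c * f (i ∸ k) (j ∸ n)) when (n ≤ᵇ j)) ⟩
  ((c * f (i ∸ m) (j ∸ n)) when (n ≤ᵇ j)) when (m ≤ᵇ i)
    ≡⟨ when-∧ _ (m ≤ᵇ i) (n ≤ᵇ j) ⟨
  (c * f (i ∸ m) (j ∸ n)) when ((m ≤ᵇ i) ∧ (n ≤ᵇ j))
    ≡⟨ cong (_when ((m ≤ᵇ i) ∧ (n ≤ᵇ j))) (ℚₚ.*-comm c _) ⟩
  (f (i ∸ m) (j ∸ n) * c) when ((m ≤ᵇ i) ∧ (n ≤ᵇ j))
    ∎
  where
  term : ∀ k l → (c when ((k ≡ᵇ m) ∧ (l ≡ᵇ n))) * f (i ∸ k) (j ∸ l)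
               ≡ ((c * f (i ∸ k) (j ∸ l)) when (l ≡ᵇ n)) when (k ≡ᵇ m)
  term k l = trans (when-*ʳ c _ ((k ≡ᵇ m) ∧ (l ≡ᵇ n))) (when-∧ _ (k ≡ᵇ m) (l ≡ᵇ n))

sumSeqs : ℕ → (List Step → ℚ) → ℚ
sumSeqs n f = sumOver (allSeqs n) f

sumSteps : (Step → ℚ) → ℚ
sumSteps φ = φ down + (φ stay + φ up)

sumSteps-cong : ∀ {φ ψ} → (∀ s → φ s ≡ ψ s) → sumSteps φ ≡ sumSteps ψ
sumSteps-cong e = cong₂ _+_ (e down) (cong₂ _+_ (e stay) (e up))

sumSeqs-suc : ∀ n f → sumSeqs (suc n) f ≡ sumSteps (λ s → sumSeqs n (λ xs → f (s ∷ xs)))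
sumSeqs-suc n f =
  trans (sumOver-++ (map (down ∷_) A) _ f)
  (cong₂ _+_ (sumOver-map (down ∷_) A f)
  (trans (sumOver-++ (map (stay ∷_) A) _ f)
  (cong₂ _+_ (sumOver-map (stay ∷_) A f)
  (trans (sumOver-++ (map (up ∷_) A) [] f)
  (trans (ℚₚ.+-identityʳ _) (sumOver-map (up ∷_) A f))))))
  where A = allSeqs n

sumSeqs-cong : ∀ n {f h} → (∀ xs → f xs ≡ h xs) → sumSeqs n f ≡ sumSeqs n h
sumSeqs-cong n = sumOver-cong (allSeqs n)

sumSeqs-cong-length : ∀ n {f h} → (∀ xs → length xs ≡ n → f xs ≡ h xs) → sumSeqs n f ≡ sumSeqs n h
sumSeqs-cong-length zero    e = cong (_+ 0ℚ) (e [] refl)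
sumSeqs-cong-length (suc n) {f} {h} e =
  trans (sumSeqs-suc n f)
  (trans (sumSteps-cong (λ s → sumSeqs-cong-length n (λ xs |xs| → e (s ∷ xs) (cong suc |xs|))))
         (sym (sumSeqs-suc n h)))

sumSeqs-zero : ∀ n {f} → (∀ xs → f xs ≡ 0ℚ) → sumSeqs n f ≡ 0ℚ
sumSeqs-zero n = sumOver-zero (allSeqs n)

sumSeqs-0 : ∀ f → sumSeqs 0 f ≡ f []
sumSeqs-0 f = ℚₚ.+-identityʳ (f [])

sumSeqs-suc-zero : ∀ n f → (∀ s xs → f (s ∷ xs) ≡ 0ℚ) → sumSeqs (suc n) f ≡ 0ℚ
sumSeqs-suc-zero n f e = trans (sumSeqs-suc n f) (sumSteps-cong (λ s → sumSeqs-zero n (e s)))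

sumSeqs-*ʳ : ∀ n c f → sumSeqs n (λ xs → f xs * c) ≡ sumSeqs n f * c
sumSeqs-*ʳ n = sumOver-*ʳ (allSeqs n)

sumSeqs-when : ∀ n f b → sumSeqs n (λ xs → f xs when b) ≡ sumSeqs n f when b
sumSeqs-when n f true  = refl
sumSeqs-when n f false = sumSeqs-zero n (λ _ → refl)

sumSeqs-* : ∀ m n f h → sumSeqs m f * sumSeqs n h ≡ sumSeqs m (λ p → sumSeqs n (λ q → f p * h q))
sumSeqs-* m n f h =
  trans (sym (sumSeqs-*ʳ m (sumSeqs n h) f))
        (sumSeqs-cong m (λ p → sym (sumOver-*ˡ (allSeqs n) (f p) h)))

sumSeqs-Σ≤ : ∀ m n (F : List Step → ℕ → ℚ) →
  sumSeqs m (λ xs → Σ≤ n (F xs)) ≡ Σ≤ n (λ k → sumSeqs m (λ xs → F xs k))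
sumSeqs-Σ≤ m zero    F = refl
sumSeqs-Σ≤ m (suc n) F =
  trans (sumOver-+ (allSeqs m) (λ xs → Σ≤ n (F xs)) (λ xs → F xs (suc n)))
        (cong (_+ sumSeqs m (λ xs → F xs (suc n))) (sumSeqs-Σ≤ m n F))

sumSeqs-up : ∀ n f → (∀ xs → f (down ∷ xs) ≡ 0ℚ) → (∀ xs → f (stay ∷ xs) ≡ 0ℚ) →
  sumSeqs (suc n) f ≡ sumSeqs n (λ xs → f (up ∷ xs))
sumSeqs-up n f down≡0 stay≡0 = begin
  sumSeqs (suc n) f                            ≡⟨ sumSeqs-suc n f ⟩
  sumSteps (λ s → sumSeqs n (λ xs → f (s ∷ xs)))
    ≡⟨ cong₂ (λ a b → a + (b + X)) (sumSeqs-zero n down≡0) (sumSeqs-zero n stay≡0) ⟩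
  0ℚ + (0ℚ + X)                                ≡⟨ cong (_+_ 0ℚ) (ℚₚ.+-identityˡ X) ⟩
  0ℚ + X                                       ≡⟨ ℚₚ.+-identityˡ X ⟩
  X                                            ∎
  where X = sumSeqs n (λ xs → f (up ∷ xs))

sumSeqs-take-drop : ∀ {l n} → l ≤ n → (H : List Step → List Step → ℚ) →
  sumSeqs n (λ xs → H (take l xs) (drop l xs)) ≡ sumSeqs l (λ u → sumSeqs (n ∸ l) (H u))
sumSeqs-take-drop {zero}          z≤n       H = sym (ℚₚ.+-identityʳ _)
sumSeqs-take-drop {suc l} {suc n} (s≤s l≤n) H =
  trans (sumSeqs-suc n _)
  (trans (sumSteps-cong (λ s → sumSeqs-take-drop l≤n (λ u → H (s ∷ u))))
         (sym (sumSeqs-suc l _)))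

-- First passages and area

-- firstPassage d xs: the walk xs started at height d + 1 visits 0 for the
-- first time at its last step.
firstPassage : ℕ → List Step → Bool
firstPassage d       []          = false
firstPassage d       (stay ∷ xs) = firstPassage d xs
firstPassage d       (up ∷ xs)   = firstPassage (suc d) xs
firstPassage zero    (down ∷ xs) = null xs
firstPassage (suc d) (down ∷ xs) = firstPassage d xs

isPositiveExcursion : List Step → Bool
isPositiveExcursion (up ∷ xs) = firstPassage 0 xs
isPositiveExcursion _         = false

-- Sum of the heights visited from height h; pred makes it meaningless for
-- walks that go below 0, but it is only used on walks that do not.
area : ℕ → List Step → ℕ
area h []          = 0
area h (down ∷ xs) = pred h ℕ.+ area (pred h) xs
area h (stay ∷ xs) = h ℕ.+ area h xs
area h (up ∷ xs)   = suc h ℕ.+ area (suc h) xs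

-- A first passage from height d + 1 + k + 1 splits uniquely, at the first
-- visit to height k + 1.
firstPassage-split : ∀ d k xs x →
  x when firstPassage (d ℕ.+ suc k) xs
    ≡ Σ≤ (length xs) (λ l → x when (firstPassage d (take l xs) ∧ firstPassage k (drop l xs)))
firstPassage-split d       k []          x = refl
firstPassage-split d       k (stay ∷ ys) x =
  trans (firstPassage-split d k ys x) (sym (Σ≤-shift-zero (length ys) _ refl))
firstPassage-split d       k (up ∷ ys)   x =
  trans (firstPassage-split (suc d) k ys x) (sym (Σ≤-shift-zero (length ys) _ refl))
firstPassage-split (suc d) k (down ∷ ys) x =
  trans (firstPassage-split d k ys x) (sym (Σ≤-shift-zero (length ys) _ refl))
firstPassage-split zero    k (down ∷ ys) x =
  trans (split-at-start ys) (sym (Σ≤-shift-zero (length ys) _ refl))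
  where
  split-at-start : ∀ ys →
    x when firstPassage k ys
      ≡ Σ≤ (length ys) (λ l → x when (null (take l ys) ∧ firstPassage k (drop l ys)))
  split-at-start []       = refl
  split-at-start (t ∷ ts) = sym (begin
    Σ≤ (suc (length ts)) (λ l → x when (null (take l (t ∷ ts)) ∧ firstPassage k (drop l (t ∷ ts))))
      ≡⟨ Σ≤-shift (length ts) _ ⟩
    (x when firstPassage k (t ∷ ts)) + Σ≤ (length ts) (λ _ → 0ℚ)
      ≡⟨ cong (_+_ (x when firstPassage k (t ∷ ts))) (Σ≤-zero (length ts) (λ _ → refl)) ⟩
    (x when firstPassage k (t ∷ ts)) + 0ℚ
      ≡⟨ ℚₚ.+-identityʳ _ ⟩
    x when firstPassage k (t ∷ ts)
      ∎)

sumSeqs-firstPassage-split : ∀ d k n (F : List Step → ℚ) →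
  sumSeqs n (λ xs → F xs when firstPassage (d ℕ.+ suc k) xs)
    ≡ Σ≤ n (λ l → sumSeqs l (λ u → sumSeqs (n ∸ l) (λ v →
                    F (u ++ v) when (firstPassage d u ∧ firstPassage k v))))
sumSeqs-firstPassage-split d k n F = begin
  sumSeqs n (λ xs → F xs when firstPassage (d ℕ.+ suc k) xs)
    ≡⟨ sumSeqs-cong-length n (λ xs |xs| →
         trans (firstPassage-split d k xs (F xs)) (cong (λ N → Σ≤ N (cut xs)) |xs|)) ⟩
  sumSeqs n (λ xs → Σ≤ n (cut xs))
    ≡⟨ sumSeqs-Σ≤ n n cut ⟩
  Σ≤ n (λ l → sumSeqs n (λ xs → cut xs l))
    ≡⟨ Σ≤-cong-≤ n (λ l l≤n →
         trans (sumSeqs-cong n (λ xs → cong (λ ws → F ws when cut-at l xs) (sym (take++drop≡id l xs))))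
               (sumSeqs-take-drop l≤n (λ u v → F (u ++ v) when (firstPassage d u ∧ firstPassage k v)))) ⟩
  Σ≤ n (λ l → sumSeqs l (λ u → sumSeqs (n ∸ l) (λ v →
                F (u ++ v) when (firstPassage d u ∧ firstPassage k v))))
    ∎
  where
  cut-at : ℕ → List Step → Bool
  cut-at l xs = firstPassage d (take l xs) ∧ firstPassage k (drop l xs)

  cut : List Step → ℕ → ℚ
  cut xs l = F xs when cut-at l xs

area-++ : ∀ d c u v → firstPassage d u ≡ true →
  area (suc d ℕ.+ c) (u ++ v) ≡ area (suc d ℕ.+ c) u ℕ.+ area c v
area-++ zero    c (down ∷ []) v _ = cong (ℕ._+ area c v) (sym (ℕₚ.+-identityʳ c))
area-++ (suc d) c (down ∷ u)  v e =
  trans (cong (suc d ℕ.+ c ℕ.+_) (area-++ d c u v e)) (sym (ℕₚ.+-assoc (suc d ℕ.+ c) _ _))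
area-++ d       c (stay ∷ u)  v e =
  trans (cong (suc d ℕ.+ c ℕ.+_) (area-++ d c u v e)) (sym (ℕₚ.+-assoc (suc d ℕ.+ c) _ _))
area-++ d       c (up ∷ u)    v e =
  trans (cong (suc (suc d ℕ.+ c) ℕ.+_) (area-++ (suc d) c u v e))
        (sym (ℕₚ.+-assoc (suc (suc d ℕ.+ c)) _ _))

+-*-interchange : ∀ h c a l → (h ℕ.+ c) ℕ.+ (a ℕ.+ l ℕ.* c) ≡ (h ℕ.+ a) ℕ.+ (c ℕ.+ l ℕ.* c)
+-*-interchange = solve-∀

area-+ : ∀ d c u → firstPassage d u ≡ true →
  area (suc d ℕ.+ c) u ≡ area (suc d) u ℕ.+ length u ℕ.* c
area-+ zero    c (down ∷ []) _ = refl
area-+ (suc d) c (down ∷ u)  e =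
  trans (cong (suc d ℕ.+ c ℕ.+_) (area-+ d c u e))
        (+-*-interchange (suc d) c (area (suc d) u) (length u))
area-+ d       c (stay ∷ u)  e =
  trans (cong (suc d ℕ.+ c ℕ.+_) (area-+ d c u e))
        (+-*-interchange (suc d) c (area (suc d) u) (length u))
area-+ d       c (up ∷ u)    e =
  trans (cong (suc (suc d ℕ.+ c) ℕ.+_) (area-+ (suc d) c u e))
        (+-*-interchange (suc (suc d)) c (area (suc (suc d)) u) (length u))

seqWeight-++ : ∀ u v → seqWeight (u ++ v) ≡ seqWeight u * seqWeight v
seqWeight-++ []      v = sym (ℚₚ.*-identityˡ _)
seqWeight-++ (s ∷ u) v =
  trans (cong (weight s *_) (seqWeight-++ u v)) (sym (ℚₚ.*-assoc (weight s) _ _))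

-- Positive excursions and the coefficients of g

firstReturnAtEnd-positions : ∀ d ys → firstReturnAtEnd (positions (+ suc d) ys) ≡ firstPassage d ys
firstReturnAtEnd-positions d       []                 = refl
firstReturnAtEnd-positions zero    (down ∷ [])        = refl
firstReturnAtEnd-positions zero    (down ∷ _ ∷ _)     = refl
firstReturnAtEnd-positions (suc d) (down ∷ [])        = refl
firstReturnAtEnd-positions (suc d) (down ∷ t ∷ ts)    = firstReturnAtEnd-positions d (t ∷ ts)
firstReturnAtEnd-positions d       (stay ∷ [])        = refl
firstReturnAtEnd-positions d       (stay ∷ t ∷ ts) =
  trans (cong (λ y → firstReturnAtEnd (positions y (t ∷ ts))) (ℤₚ.+-identityʳ (+ suc d)))
        (firstReturnAtEnd-positions d (t ∷ ts))
firstReturnAtEnd-positions d       (up ∷ [])          = refl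
firstReturnAtEnd-positions d       (up ∷ t ∷ ts) =
  trans (cong (λ y → firstReturnAtEnd (positions y (t ∷ ts))) (ℤₚ.+-comm (+ suc d) (+ 1)))
        (firstReturnAtEnd-positions (suc d) (t ∷ ts))

sumℤ-positions : ∀ d ys → firstPassage d ys ≡ true →
  sumℤ (positions (+ suc d) ys) ≡ + area (suc d) ys
sumℤ-positions zero    (down ∷ [])  _ = refl
sumℤ-positions (suc d) (down ∷ ys)  e = cong (ℤ._+_ (+ suc d)) (sumℤ-positions d ys e)
sumℤ-positions d       (stay ∷ ys)  e
  rewrite ℤₚ.+-identityʳ (+ suc d) = cong (ℤ._+_ (+ suc d)) (sumℤ-positions d ys e)
sumℤ-positions d       (up ∷ ys)    e
  rewrite ℤₚ.+-comm (+ suc d) (+ 1) = cong (ℤ._+_ (+ suc (suc d))) (sumℤ-positions (suc d) ys e)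

-- Including the starting point is what makes the sum strictly negative.
negativeExcursion-sum : ∀ d ys → firstReturnAtEnd (-[1+ d ] ∷ positions -[1+ d ] ys) ≡ true →
  ∃[ m ] sumℤ (-[1+ d ] ∷ positions -[1+ d ] ys) ≡ -[1+ m ]
negativeExcursion-sum d       (down ∷ ys)     e
  rewrite ℤₚ.+-comm -[1+ d ] -[1+ 0 ] with negativeExcursion-sum (suc d) ys e
... | m , s = suc (d ℕ.+ m) , cong (ℤ._+_ -[1+ d ]) s
negativeExcursion-sum d       (stay ∷ ys)     e
  rewrite ℤₚ.+-identityʳ -[1+ d ] with negativeExcursion-sum d ys e
... | m , s = suc (d ℕ.+ m) , cong (ℤ._+_ -[1+ d ]) s
negativeExcursion-sum (suc d) (up ∷ ys)       e with negativeExcursion-sum d ys e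
... | m , s = suc (suc d ℕ.+ m) , cong (ℤ._+_ -[1+ suc d ]) s
negativeExcursion-sum zero    (up ∷ [])       _ = 0 , refl

-- Walks starting downwards have negative area, hence never contribute to g.
event-positive : ∀ a xs → event (+ suc a) xs ≡ isPositiveExcursion xs ∧ (area 0 xs ≡ᵇ suc a)
event-positive a []                = refl
event-positive a (down ∷ ys)
  with firstReturnAtEnd (-[1+ 0 ] ∷ positions -[1+ 0 ] ys) in returns
... | false = refl
... | true with negativeExcursion-sum 0 ys returns
...   | m , s rewrite s = refl
event-positive a (stay ∷ [])       = refl
event-positive a (stay ∷ _ ∷ _)    = refl
event-positive a (up ∷ [])         = refl
event-positive a (up ∷ t ∷ ts)
  rewrite firstReturnAtEnd-positions 0 (t ∷ ts) with firstPassage 0 (t ∷ ts) in passes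
... | false = refl
... | true rewrite sumℤ-positions 0 (t ∷ ts) passes = refl

excursionTerm : ℕ → List Step → ℚ
excursionTerm a xs = seqWeight xs when (isPositiveExcursion xs ∧ (area 0 xs ≡ᵇ a))

excursionTerm-zero : ∀ xs → excursionTerm 0 xs ≡ 0ℚ
excursionTerm-zero []          = refl
excursionTerm-zero (down ∷ _)  = refl
excursionTerm-zero (stay ∷ _)  = refl
excursionTerm-zero (up ∷ ys)   = cong (seqWeight (up ∷ ys) when_) (∧-zeroʳ (firstPassage 0 ys))

g≡sumExcursions : ∀ i j → g i j ≡ sumSeqs j (excursionTerm i)
g≡sumExcursions zero    j       = sym (sumSeqs-zero j excursionTerm-zero)
g≡sumExcursions (suc a) zero    = refl
g≡sumExcursions (suc a) (suc j) =
  sumSeqs-cong (suc j) (λ xs → cong (seqWeight xs when_) (event-positive a xs))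

-- In g(x, x y) an excursion p of length m carries the monomial x^(m + area p) y^m.
excursionPair : ℕ → ℕ → List Step → List Step → ℚ
excursionPair m i p q =
  ((seqWeight p * seqWeight q) when (m ℕ.+ area 0 p ℕ.+ area 0 q ≡ᵇ i))
    when (isPositiveExcursion p ∧ isPositiveExcursion q)

excursionPair-zeroʳ : ∀ m i p q → isPositiveExcursion q ≡ false → excursionPair m i p q ≡ 0ℚ
excursionPair-zeroʳ m i p q e =
  cong (((seqWeight p * seqWeight q) when (m ℕ.+ area 0 p ℕ.+ area 0 q ≡ᵇ i)) when_)
       (trans (cong (isPositiveExcursion p ∧_) e) (∧-zeroʳ (isPositiveExcursion p)))

excursionTerm-convolution : ∀ i m p q →
  Σ≤ i (λ k → (excursionTerm (k ∸ m) p when (m ≤ᵇ k)) * excursionTerm (i ∸ k) q)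
    ≡ excursionPair m i p q
excursionTerm-convolution i m p q = begin
  Σ≤ i (λ k → (excursionTerm (k ∸ m) p when (m ≤ᵇ k)) * excursionTerm (i ∸ k) q)
    ≡⟨ Σ≤-cong i (λ k → rearrange (m ≤ᵇ k) (isPositiveExcursion p) (area 0 p ≡ᵇ k ∸ m)
                                   (isPositiveExcursion q) (area 0 q ≡ᵇ i ∸ k)
                                   (seqWeight p) (seqWeight q)) ⟩
  Σ≤ i (λ k → (w when (((m ≤ᵇ k) ∧ (area 0 p ≡ᵇ k ∸ m)) ∧ (area 0 q ≡ᵇ i ∸ k))) when E)
    ≡⟨ Σ≤-when i _ E ⟩
  Σ≤ i (λ k → w when (((m ≤ᵇ k) ∧ (area 0 p ≡ᵇ k ∸ m)) ∧ (area 0 q ≡ᵇ i ∸ k))) when E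
    ≡⟨ cong (_when E) (Σ≤-convolution-delta i m (area 0 p) (area 0 q) w) ⟩
  excursionPair m i p q
    ∎
  where
  w = seqWeight p * seqWeight q
  E = isPositiveExcursion p ∧ isPositiveExcursion q

  rearrange : ∀ M E X F Y x y →
    ((x when (E ∧ X)) when M) * (y when (F ∧ Y)) ≡ ((x * y) when ((M ∧ X) ∧ Y)) when (E ∧ F)
  rearrange M     false X F     Y x y =
    trans (cong (_* (y when (F ∧ Y))) (0-when M)) (ℚₚ.*-zeroˡ (y when (F ∧ Y)))
  rearrange M     true  X false Y x y = ℚₚ.*-zeroʳ ((x when X) when M)
  rearrange false true  X true  Y x y = ℚₚ.*-zeroˡ (y when Y)
  rearrange true  true  X true  Y x y = when-* x y X Y

g⊛substXYg : ∀ i j → (g ⊛ substXY g) i j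
  ≡ Σ≤ j (λ m → sumSeqs m (λ p → sumSeqs (j ∸ m) (λ q → excursionPair m i p q)))
g⊛substXYg i j = begin
  (g ⊛ substXY g) i j
    ≡⟨ ⊛-comm g (substXY g) i j ⟩
  Σ≤ i (λ k → Σ≤ j (λ m → (g (k ∸ m) m when (m ≤ᵇ k)) * g (i ∸ k) (j ∸ m)))
    ≡⟨ Σ≤-swap i j _ ⟩
  Σ≤ j (λ m → Σ≤ i (λ k → (g (k ∸ m) m when (m ≤ᵇ k)) * g (i ∸ k) (j ∸ m)))
    ≡⟨ Σ≤-cong j (λ m → Σ≤-cong i (λ k → expand m k)) ⟩
  Σ≤ j (λ m → Σ≤ i (λ k → sumSeqs m (λ p → sumSeqs (j ∸ m) (λ q → term m k p q))))
    ≡⟨ Σ≤-cong j (λ m → sym (trans (sumSeqs-cong m (λ p → sumSeqs-Σ≤ (j ∸ m) i (λ q k → term m k p q)))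
                                   (sumSeqs-Σ≤ m i (λ p k → sumSeqs (j ∸ m) (term m k p))))) ⟩
  Σ≤ j (λ m → sumSeqs m (λ p → sumSeqs (j ∸ m) (λ q → Σ≤ i (λ k → term m k p q))))
    ≡⟨ Σ≤-cong j (λ m → sumSeqs-cong m (λ p → sumSeqs-cong (j ∸ m) (λ q →
         excursionTerm-convolution i m p q))) ⟩
  Σ≤ j (λ m → sumSeqs m (λ p → sumSeqs (j ∸ m) (λ q → excursionPair m i p q)))
    ∎
  where
  term : ℕ → ℕ → List Step → List Step → ℚ
  term m k p q = (excursionTerm (k ∸ m) p when (m ≤ᵇ k)) * excursionTerm (i ∸ k) q

  expand : ∀ m k → (g (k ∸ m) m when (m ≤ᵇ k)) * g (i ∸ k) (j ∸ m)
                 ≡ sumSeqs m (λ p → sumSeqs (j ∸ m) (λ q → term m k p q))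
  expand m k = begin
    (g (k ∸ m) m when (m ≤ᵇ k)) * g (i ∸ k) (j ∸ m)
      ≡⟨ cong₂ (λ a b → (a when (m ≤ᵇ k)) * b)
               (g≡sumExcursions (k ∸ m) m) (g≡sumExcursions (i ∸ k) (j ∸ m)) ⟩
    (sumSeqs m (excursionTerm (k ∸ m)) when (m ≤ᵇ k)) * Q
      ≡⟨ cong (_* Q) (sumSeqs-when m (excursionTerm (k ∸ m)) (m ≤ᵇ k)) ⟨
    sumSeqs m (λ p → excursionTerm (k ∸ m) p when (m ≤ᵇ k)) * Q
      ≡⟨ sumSeqs-* m (j ∸ m) _ _ ⟩
    sumSeqs m (λ p → sumSeqs (j ∸ m) (λ q → term m k p q))
      ∎
    where Q = sumSeqs (j ∸ m) (excursionTerm (i ∸ k))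

-- Pairs in which p or q is empty vanish, and the others start with up-steps.
g⊛substXYg-up : ∀ i n → (g ⊛ substXY g) i (suc (suc n))
  ≡ Σ≤ n (λ l → sumSeqs l (λ u → sumSeqs (n ∸ l) (λ v → excursionPair (suc l) i (up ∷ u) (up ∷ v))))
g⊛substXYg-up i n = begin
  (g ⊛ substXY g) i (suc (suc n))       ≡⟨ g⊛substXYg i (suc (suc n)) ⟩
  Σ≤ (suc n) pairSum + pairSum (suc (suc n))
    ≡⟨ cong₂ _+_ (Σ≤-shift-zero n pairSum pairSum-0) pairSum-last ⟩
  Σ≤ n (λ l → pairSum (suc l)) + 0ℚ     ≡⟨ ℚₚ.+-identityʳ _ ⟩
  Σ≤ n (λ l → pairSum (suc l))          ≡⟨ Σ≤-cong-≤ n pairSum-up ⟩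
  Σ≤ n (λ l → sumSeqs l (λ u → sumSeqs (n ∸ l) (λ v → excursionPair (suc l) i (up ∷ u) (up ∷ v))))
    ∎
  where
  pairSum : ℕ → ℚ
  pairSum m = sumSeqs m (λ p → sumSeqs (suc (suc n) ∸ m) (λ q → excursionPair m i p q))

  pairSum-0 : pairSum 0 ≡ 0ℚ
  pairSum-0 = sumSeqs-zero 0 (λ _ → sumSeqs-zero (suc (suc n)) (λ _ → refl))

  pairSum-last : pairSum (suc (suc n)) ≡ 0ℚ
  pairSum-last = sumSeqs-zero (suc (suc n)) (λ p →
    trans (cong (λ N → sumSeqs N (excursionPair (suc (suc n)) i p)) (ℕₚ.n∸n≡0 n))
          (trans (sumSeqs-0 (excursionPair (suc (suc n)) i p))
                 (excursionPair-zeroʳ (suc (suc n)) i p [] refl)))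

  pairSum-up : ∀ l → l ≤ n → pairSum (suc l)
    ≡ sumSeqs l (λ u → sumSeqs (n ∸ l) (λ v → excursionPair (suc l) i (up ∷ u) (up ∷ v)))
  pairSum-up l l≤n =
    trans (sumSeqs-up l _ (λ _ → sumSeqs-zero (suc n ∸ l) (λ _ → refl))
                          (λ _ → sumSeqs-zero (suc n ∸ l) (λ _ → refl)))
          (sumSeqs-cong l (λ u →
            trans (cong (λ N → sumSeqs N (excursionPair (suc l) i (up ∷ u))) (ℕₚ.+-∸-assoc 1 l≤n))
                  (sumSeqs-up (n ∸ l) _ (λ q → excursionPair-zeroʳ (suc l) i (up ∷ u) (down ∷ q) refl)
                                        (λ q → excursionPair-zeroʳ (suc l) i (up ∷ u) (stay ∷ q) refl))))

-- First-step decomposition of an excursion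

sumExcursions-up : ∀ a n →
  sumSeqs (suc n) (excursionTerm a) ≡ sumSeqs n (λ ys → excursionTerm a (up ∷ ys))
sumExcursions-up a n = sumSeqs-up n (excursionTerm a) (λ _ → refl) (λ _ → refl)

excursions-up-down : ∀ a n →
  sumSeqs n (λ ys → excursionTerm (suc a) (up ∷ down ∷ ys)) ≡ mono (+ 1 / 16) 1 2 (suc a) (suc (suc n))
excursions-up-down zero    zero    = refl
excursions-up-down (suc a) zero    = refl
excursions-up-down zero    (suc n) = sumSeqs-suc-zero n _ (λ _ _ → refl)
excursions-up-down (suc a) (suc n) = sumSeqs-suc-zero n _ (λ _ _ → refl)

excursions-up-stay : ∀ a n →
  sumSeqs n (λ ys → excursionTerm (suc a) (up ∷ stay ∷ ys))
    ≡ sumSeqs (suc n) (excursionTerm a) * (+ 1 / 2)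
excursions-up-stay a n = begin
  sumSeqs n (λ ys → excursionTerm (suc a) (up ∷ stay ∷ ys))
    ≡⟨ sumSeqs-cong n staying ⟩
  sumSeqs n (λ ys → excursionTerm a (up ∷ ys) * (+ 1 / 2))
    ≡⟨ sumSeqs-*ʳ n (+ 1 / 2) _ ⟩
  sumSeqs n (λ ys → excursionTerm a (up ∷ ys)) * (+ 1 / 2)
    ≡⟨ cong (_* (+ 1 / 2)) (sumExcursions-up a n) ⟨
  sumSeqs (suc n) (excursionTerm a) * (+ 1 / 2)
    ∎
  where
  staying : ∀ ys → excursionTerm (suc a) (up ∷ stay ∷ ys) ≡ excursionTerm a (up ∷ ys) * (+ 1 / 2)
  staying ys =
    trans (cong (_when b) (solve 1 (λ w → con (+ 1 / 4) :* (con (+ 1 / 2) :* w)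
                                     := (con (+ 1 / 4) :* w) :* con (+ 1 / 2)) refl (seqWeight ys)))
          (sym (when-*ʳ (+ 1 / 4 * seqWeight ys) (+ 1 / 2) b))
    where b = firstPassage 0 ys ∧ (suc (area 1 ys) ≡ᵇ a)

area-up-up : ∀ u v → firstPassage 0 u ≡ true →
  area 0 (up ∷ up ∷ (u ++ v)) ≡ suc (length u) ℕ.+ area 0 (up ∷ u) ℕ.+ area 0 (up ∷ v)
area-up-up u v e = begin
  3 ℕ.+ area 2 (u ++ v)                            ≡⟨ cong (3 ℕ.+_) (area-++ 0 1 u v e) ⟩
  3 ℕ.+ (area 2 u ℕ.+ area 1 v)                    ≡⟨ cong (λ x → 3 ℕ.+ (x ℕ.+ area 1 v)) (area-+ 0 1 u e) ⟩
  3 ℕ.+ (area 1 u ℕ.+ length u ℕ.* 1 ℕ.+ area 1 v) ≡⟨ rearrange (area 1 u) (length u) (area 1 v) ⟩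
  suc (length u) ℕ.+ suc (area 1 u) ℕ.+ suc (area 1 v) ∎
  where
  rearrange : ∀ A L B → 3 ℕ.+ (A ℕ.+ L ℕ.* 1 ℕ.+ B) ≡ suc L ℕ.+ suc A ℕ.+ suc B
  rearrange = solve-∀

seqWeight-up-up : ∀ u v → seqWeight (up ∷ up ∷ (u ++ v)) ≡ seqWeight (up ∷ u) * seqWeight (up ∷ v)
seqWeight-up-up u v =
  trans (cong (λ w → + 1 / 4 * (+ 1 / 4 * w)) (seqWeight-++ u v))
        (solve 2 (λ x y → con (+ 1 / 4) :* (con (+ 1 / 4) :* (x :* y))
                          := (con (+ 1 / 4) :* x) :* (con (+ 1 / 4) :* y)) refl (seqWeight u) (seqWeight v))

excursions-up-up : ∀ a n →
  sumSeqs n (λ zs → excursionTerm (suc a) (up ∷ up ∷ zs)) ≡ (g ⊛ substXY g) (suc a) (suc (suc n))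
excursions-up-up a n = begin
  sumSeqs n (λ zs → excursionTerm (suc a) (up ∷ up ∷ zs))
    ≡⟨ sumSeqs-cong n (λ zs → when-∧ (seqWeight (up ∷ up ∷ zs)) (firstPassage 1 zs) _) ⟩
  sumSeqs n (λ zs → upUpTerm zs when firstPassage 1 zs)
    ≡⟨ sumSeqs-firstPassage-split 0 0 n upUpTerm ⟩
  Σ≤ n (λ l → sumSeqs l (λ u → sumSeqs (n ∸ l) (λ v →
                upUpTerm (u ++ v) when (firstPassage 0 u ∧ firstPassage 0 v))))
    ≡⟨ Σ≤-cong n (λ l → sumSeqs-cong-length l (λ u |u| → sumSeqs-cong (n ∸ l) (λ v →
         splitTerm≡excursionPair l u v |u|))) ⟩
  Σ≤ n (λ l → sumSeqs l (λ u → sumSeqs (n ∸ l) (λ v →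
                excursionPair (suc l) (suc a) (up ∷ u) (up ∷ v))))
    ≡⟨ g⊛substXYg-up (suc a) n ⟨
  (g ⊛ substXY g) (suc a) (suc (suc n))
    ∎
  where
  upUpTerm : List Step → ℚ
  upUpTerm zs = seqWeight (up ∷ up ∷ zs) when (area 0 (up ∷ up ∷ zs) ≡ᵇ suc a)

  splitTerm≡excursionPair : ∀ l u v → length u ≡ l →
    upUpTerm (u ++ v) when (firstPassage 0 u ∧ firstPassage 0 v)
      ≡ excursionPair (suc l) (suc a) (up ∷ u) (up ∷ v)
  splitTerm≡excursionPair .(length u) u v refl with firstPassage 0 u in passes
  ... | false = refl
  ... | true  = cong (_when firstPassage 0 v)
                     (cong₂ _when_ (seqWeight-up-up u v) (cong (_≡ᵇ suc a) (area-up-up u v passes)))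

g-y<2 : ∀ k l → l ≤ 1 → g k l ≡ 0ℚ
g-y<2 zero    l                _         = refl
g-y<2 (suc k) zero             _         = refl
g-y<2 (suc k) (suc zero)       _         = refl
g-y<2 (suc k) (suc (suc l))    (s≤s ())

⊛-y≤ : ∀ f h i j → (∀ k l → l ≤ j → f k l ≡ 0ℚ) → (f ⊛ h) i j ≡ 0ℚ
⊛-y≤ f h i j e = Σ≤-zero i (λ k →
  trans (Σ≤-cong-≤ j (λ l l≤j → trans (cong (_* h (i ∸ k) (j ∸ l)) (e k l l≤j))
                                       (ℚₚ.*-zeroˡ (h (i ∸ k) (j ∸ l)))))
        (Σ≤-zero j (λ _ → refl)))

g⊛-y<2 : ∀ h i j → j ≤ 1 → (g ⊛ h) i j ≡ 0ℚ
g⊛-y<2 h i j j≤1 = ⊛-y≤ g h i j (λ k l l≤j → g-y<2 k l (ℕₚ.≤-trans l≤j j≤1))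

g⊛-x⁰ : ∀ h j → (g ⊛ h) 0 j ≡ 0ℚ
g⊛-x⁰ h j = Σ≤-zero j (λ l → ℚₚ.*-zeroˡ (h 0 (j ∸ l)))

sum-of-zeros : ∀ {x y z} → x ≡ 0ℚ → y ≡ 0ℚ → z ≡ 0ℚ → x + y + z ≡ 0ℚ
sum-of-zeros refl refl refl = refl

g-recursion : ∀ i j →
  g i j ≡ mono (+ 1 / 16) 1 2 i j + (g ⊛ mono (+ 1 / 2) 1 1) i j + (g ⊛ substXY g) i j
g-recursion zero j = sym (sum-of-zeros refl (g⊛-x⁰ (mono (+ 1 / 2) 1 1) j) (g⊛-x⁰ (substXY g) j))
g-recursion (suc a) zero =
  sym (sum-of-zeros (cong (+ 1 / 16 when_) (∧-zeroʳ (a ≡ᵇ 0)))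
                    (g⊛-y<2 (mono (+ 1 / 2) 1 1) (suc a) 0 z≤n) (g⊛-y<2 (substXY g) (suc a) 0 z≤n))
g-recursion (suc a) (suc zero) =
  sym (sum-of-zeros (cong (+ 1 / 16 when_) (∧-zeroʳ (a ≡ᵇ 0)))
                    (g⊛-y<2 (mono (+ 1 / 2) 1 1) (suc a) 1 (s≤s z≤n))
                    (g⊛-y<2 (substXY g) (suc a) 1 (s≤s z≤n)))
g-recursion (suc a) (suc (suc n)) = begin
  g (suc a) (suc (suc n))
    ≡⟨ g≡sumExcursions (suc a) (suc (suc n)) ⟩
  sumSeqs (suc (suc n)) (excursionTerm (suc a))
    ≡⟨ sumExcursions-up (suc a) (suc n) ⟩
  sumSeqs (suc n) (λ ys → excursionTerm (suc a) (up ∷ ys))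
    ≡⟨ sumSeqs-suc n _ ⟩
  sumSteps (λ s → sumSeqs n (λ ys → excursionTerm (suc a) (up ∷ s ∷ ys)))
    ≡⟨ cong₂ _+_ (excursions-up-down a n)
                 (cong₂ _+_ (trans (excursions-up-stay a n)
                                   (cong (_* (+ 1 / 2)) (sym (g≡sumExcursions a (suc n)))))
                            (excursions-up-up a n)) ⟩
  M + (g a (suc n) * (+ 1 / 2) + G)
    ≡⟨ ℚₚ.+-assoc M _ G ⟨
  M + g a (suc n) * (+ 1 / 2) + G
    ≡⟨ cong (λ x → M + x + G) (⊛-mono g (+ 1 / 2) 1 1 (suc a) (suc (suc n))) ⟨
  M + (g ⊛ mono (+ 1 / 2) 1 1) (suc a) (suc (suc n)) + G
    ∎
  where
  M = mono (+ 1 / 16) 1 2 (suc a) (suc (suc n))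
  G = (g ⊛ substXY g) (suc a) (suc (suc n))

lemma5p1 : ∀ i j →
    ((+ 16 / 1) · (g ⊛ ((mono (+ 1 / 1) 0 0 ⊖ mono (+ 1 / 2) 1 1) ⊖ substXY g))) i j
      ≡ mono (+ 1 / 1) 1 2 i j
lemma5p1 i j = begin
  + 16 / 1 * (g ⊛ ((mono (+ 1 / 1) 0 0 ⊖ H) ⊖ substXY g)) i j
    ≡⟨ cong (+ 16 / 1 *_) (trans (⊛-⊖ g (mono (+ 1 / 1) 0 0 ⊖ H) (substXY g) i j)
                                 (cong (_- Z) (⊛-⊖ g (mono (+ 1 / 1) 0 0) H i j))) ⟩
  + 16 / 1 * ((g ⊛ mono (+ 1 / 1) 0 0) i j - Y - Z)
    ≡⟨ cong (λ x → + 16 / 1 * (x - Y - Z)) (⊛-mono g (+ 1 / 1) 0 0 i j) ⟩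
  + 16 / 1 * (g i j * (+ 1 / 1) - Y - Z)
    ≡⟨ cong (λ x → + 16 / 1 * (x * (+ 1 / 1) - Y - Z)) (g-recursion i j) ⟩
  + 16 / 1 * ((X + Y + Z) * (+ 1 / 1) - Y - Z)
    ≡⟨ cong (+ 16 / 1 *_)
            (solve 3 (λ x y z → (x :+ y :+ z) :* con (+ 1 / 1) :- y :- z := x) refl X Y Z) ⟩
  + 16 / 1 * X
    ≡⟨ scale ((i ≡ᵇ 1) ∧ (j ≡ᵇ 2)) ⟩
  mono (+ 1 / 1) 1 2 i j
    ∎
  where
  H = mono (+ 1 / 2) 1 1
  X = mono (+ 1 / 16) 1 2 i j
  Y = (g ⊛ H) i j
  Z = (g ⊛ substXY g) i j
  scale : ∀ b → + 16 / 1 * (+ 1 / 16 when b) ≡ + 1 / 1 when b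
  scale true  = refl
  scale false = refl
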